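{- Let $S$ be a finite set and let $G$ be a one-out directed graph with vertex set $2^S$ (every vertex has exactly one outgoing edge). Then $G$ is the $0$-context graph of some reaction system with background set $S$ if and only if $(\varnothing,\varnothing)$ and $(S,\varnothing)$ are edges of $G$.
   Context: A reaction system is a pair $\mathcal A=(S,A)$ with $S$ a finite set (the background set) and $A\subseteq(2^S\setminus\{\varnothing\})\times(2^S\setminus\{\varnothing\})\times 2^S$ a set of reactions $(R,I,P)$ (reactant, inhibitor, product; $R$ and $I$ nonempty). A reaction $a=(R,I,P)$ is enabled in $X\subseteq S$ iff $R\subseteq X$ and $I\cap X=\varnothing$; $\mathrm{res}_a(X)=P$ if $a$ is enabled in $X$ and $\varnothing$ otherwise; $\mathrm{res}_{\mathcal A}(X)=\bigcup_{a\in A}\mathrm{res}_a(X)$. The $0$-context graph of $\mathcal A$ is the one-out graph $G^0_{\mathcal A}$ with vertex set $2^S$ and edge set $\{(v,\mathrm{res}_{\mathcal A}(v))\mid v\in 2^S\}$. -}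

module Defs where

open import Data.Nat using (ℕ)
open import Data.List using (List; map)
open import Data.Product using (_×_; _,_)
open import Data.Fin.Subset using (Subset; _⊆_; _∩_; ⋃; ⊥; Nonempty; Empty)
open import Data.Fin.Subset.Properties using (_⊆?_; nonempty?)
open import Relation.Nullary using (Dec; yes; no; ¬?)
open import Relation.Nullary.Decidable using (_×-dec_)
open import Relation.Binary.PropositionalEquality using (_≡_)

-- The background set S is Fin n (an arbitrary finite set, up to bijection);
-- subsets of S (elements of 2^S) are Data.Fin.Subset.Subset n.

record Reaction (n : ℕ) : Set where
  constructor reaction
  field
    R : Subset n
    I : Subset n
    P : Subset n
    R-nonempty : Nonempty R
    I-nonempty : Nonempty I

open Reaction public

ReactionSystem : ℕ → Set
ReactionSystem n = List (Reaction n)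

Enabled : ∀ {n} → Reaction n → Subset n → Set
Enabled a X = (R a ⊆ X) × Empty (I a ∩ X)

enabled? : ∀ {n} (a : Reaction n) (X : Subset n) → Dec (Enabled a X)
enabled? a X = (R a ⊆? X) ×-dec ¬? (nonempty? (I a ∩ X))

resᵣ : ∀ {n} → Reaction n → Subset n → Subset n
resᵣ a X with enabled? a X
... | yes _ = P a
... | no  _ = ⊥

res : ∀ {n} → ReactionSystem n → Subset n → Subset n
res A X = ⋃ (map (λ a → resᵣ a X) A)

-- A one-out directed graph with vertex set 2^S: each vertex v has exactly one
-- outgoing edge (v, succ v); represented by its successor function.
OneOutGraph : ℕ → Set
OneOutGraph n = Subset n → Subset n

IsEdge : ∀ {n} → OneOutGraph n → Subset n → Subset n → Set
IsEdge G u v = G u ≡ v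

zeroContextGraph : ∀ {n} → ReactionSystem n → OneOutGraph n
zeroContextGraph A = res A

module Submission where

-- Both directions rest on one observation about enabledness: a reaction
-- (R, I, P) is never enabled at ∅ (R is nonempty) nor at S (I is nonempty),
-- while for a proper subset v (∅ ≠ v ≠ S) the "selector" reaction
-- (v, S ∖ v, P) is enabled at exactly the one state v.
--
-- Necessity
-- then follows because no reaction is enabled at ∅ or S, so res_A is empty
-- there.  Sufficiency is witnessed by the system containing, for every
-- proper subset v, the selector reaction (v, S ∖ v, G v): at a proper state
-- X only the selector of X fires and produces G X; at ∅ and S nothing fires,
-- matching the hypotheses G ∅ = G S = ∅.

open import Defs
open import Data.Nat using (ℕ; zero; suc)
open import Data.Product using (Σ; _×_; _,_; proj₁; proj₂)
open import Data.Sum using (_⊎_; inj₁; inj₂)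
open import Data.Empty using () renaming (⊥-elim to absurd)
open import Data.Fin.Subset using (Subset; ⊥; ⊤; ∁; Nonempty; outside; inside)
  renaming (_∈_ to _∈ₛ_; _⊆_ to _⊆ₛ_)
open import Data.Fin.Subset.Properties
  using (∉⊥; ⊥⊆; ∈⊤; ⊆⊤; ⊆-antisym; Empty-unique; nonempty?; _∈?_;
         x∈p∪q⁻; p⊆p∪q; q⊆p∪q; x∈p∩q⁺; x∈p∩q⁻; x∉p⇒x∈∁p; x∈∁p⇒x∉p; x∉∁p⇒x∈p)
open import Data.List using (List; []; _∷_; map; _++_)
open import Data.List.Membership.Propositional using (_∈_)
open import Data.List.Membership.Propositional.Properties using (∈-map⁺; ∈-++⁺ˡ; ∈-++⁺ʳ)
open import Data.List.Relation.Unary.Any using (here; there)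
open import Data.Vec using (_∷_; [])
open import Function.Base using (_∘_)
open import Function.Bundles using (_⇔_; mk⇔)
open import Relation.Nullary using (Dec; yes; no; ¬_)
open import Relation.Nullary.Decidable using (_×-dec_)
open import Relation.Binary.PropositionalEquality using (_≡_; refl; sym; trans; subst)

private
  variable
    n : ℕ
    a : Reaction n
    A : ReactionSystem n
    X Y v Z : Subset n

resᵣ-enabled : Enabled a X → resᵣ a X ≡ P a
resᵣ-enabled {a = a} {X = X} en with enabled? a X
... | yes _   = refl
... | no ¬en = absurd (¬en en)

resᵣ-disabled : ¬ Enabled a X → resᵣ a X ≡ ⊥
resᵣ-disabled {a = a} {X = X} ¬en with enabled? a X
... | yes en = absurd (¬en en)
... | no _   = refl

res-⊆ : (A : ReactionSystem n) → (∀ {a} → a ∈ A → resᵣ a X ⊆ₛ Y) → res A X ⊆ₛ Y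
res-⊆ []      bound x∈ = absurd (∉⊥ x∈)
res-⊆ {X = X} (a ∷ A) bound x∈ with x∈p∪q⁻ (resᵣ a X) (res A X) x∈
... | inj₁ x∈a = bound (here refl) x∈a
... | inj₂ x∈A = res-⊆ A (bound ∘ there) x∈A

resᵣ-⊆-res : a ∈ A → resᵣ a X ⊆ₛ res A X
resᵣ-⊆-res {A = a ∷ A} (here refl) = p⊆p∪q (res A _)
resᵣ-⊆-res {A = b ∷ A} {X = X} (there a∈A) = q⊆p∪q (resᵣ b X) (res A X) ∘ resᵣ-⊆-res a∈A

res-inert : (A : ReactionSystem n) → (∀ {a} → a ∈ A → ¬ Enabled a X) → res A X ≡ ⊥
res-inert A inert =
  ⊆-antisym (res-⊆ A (λ a∈A → ⊥⊆ ∘ subst (_ ∈ₛ_) (resᵣ-disabled (inert a∈A)))) ⊥⊆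

disabled-at-∅ : (a : Reaction n) → ¬ Enabled a ⊥
disabled-at-∅ a (R⊆∅ , _) = ∉⊥ (R⊆∅ (proj₂ (R-nonempty a)))

disabled-at-S : (a : Reaction n) → ¬ Enabled a ⊤
disabled-at-S a (_ , I∩S-empty) =
  I∩S-empty (proj₁ (I-nonempty a) , x∈p∩q⁺ (proj₂ (I-nonempty a) , ∈⊤))

Proper : Subset n → Set
Proper v = Nonempty v × Nonempty (∁ v)

proper? : (v : Subset n) → Dec (Proper v)
proper? v = nonempty? v ×-dec nonempty? (∁ v)

improper⇒∅⊎S : ¬ Proper v → v ≡ ⊥ ⊎ v ≡ ⊤
improper⇒∅⊎S {v = v} ¬proper with nonempty? v
... | no  empty    = inj₁ (Empty-unique empty)
... | yes nonempty = inj₂ (⊆-antisym ⊆⊤ (λ _ → x∉∁p⇒x∈p (λ x∈∁v → ¬proper (nonempty , (_ , x∈∁v)))))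

selector : (v Z : Subset n) → Proper v → Reaction n
selector v Z (v≢∅ , v≢S) = reaction v (∁ v) Z v≢∅ v≢S

selector-enabled-at : (proper : Proper v) → Enabled (selector v Z proper) v
selector-enabled-at {v = v} _ =
  (λ x∈v → x∈v) , λ (x , x∈∁v∩v) → let (x∈∁v , x∈v) = x∈p∩q⁻ (∁ v) v x∈∁v∩v in x∈∁p⇒x∉p x∈∁v x∈v

selector-enabled⇒≡ : (proper : Proper v) → Enabled (selector v Z proper) X → X ≡ v
selector-enabled⇒≡ {v = v} {X = X} _ (v⊆X , ∁v∩X-empty) = ⊆-antisym X⊆v v⊆X
  where
  X⊆v : X ⊆ₛ v
  X⊆v {x} x∈X with x ∈? v
  ... | yes x∈v = x∈v
  ... | no  x∉v = absurd (∁v∩X-empty (x , x∈p∩q⁺ (x∉p⇒x∈∁p x∉v , x∈X)))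

resᵣ-selector-⊆ : (G : OneOutGraph n) (proper : Proper v) → resᵣ (selector v (G v) proper) X ⊆ₛ G X
resᵣ-selector-⊆ {v = v} {X = X} G proper {x} x∈
  with enabled? (selector v (G v) proper) X
... | yes en = subst (λ Y → x ∈ₛ G Y) (sym (selector-enabled⇒≡ {Z = G v} proper en)) x∈
... | no  _  = absurd (∉⊥ {x = x} x∈)

-- An explicit enumeration of 2^S, needed to make the reaction system finite.

allSubsets : (n : ℕ) → List (Subset n)
allSubsets zero    = [] ∷ []
allSubsets (suc n) = map (outside ∷_) (allSubsets n) ++ map (inside ∷_) (allSubsets n)

∈-allSubsets : (v : Subset n) → v ∈ allSubsets n
∈-allSubsets []                    = here refl
∈-allSubsets {suc n} (outside ∷ v) = ∈-++⁺ˡ (∈-map⁺ (outside ∷_) (∈-allSubsets v))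
∈-allSubsets {suc n} (inside ∷ v)  =
  ∈-++⁺ʳ (map (outside ∷_) (allSubsets n)) (∈-map⁺ (inside ∷_) (∈-allSubsets v))

module Realisation (G : OneOutGraph n) where

  selectors : List (Subset n) → ReactionSystem n
  selectors []       = []
  selectors (v ∷ vs) with proper? v
  ... | yes proper = selector v (G v) proper ∷ selectors vs
  ... | no  _      = selectors vs

  selectors-⊆ : (vs : List (Subset n)) → a ∈ selectors vs → resᵣ a X ⊆ₛ G X
  selectors-⊆ (v ∷ vs) a∈ with proper? v | a∈
  ... | yes proper | here refl = resᵣ-selector-⊆ G proper
  ... | yes _      | there a∈′ = selectors-⊆ vs a∈′
  ... | no  _      | a∈′       = selectors-⊆ vs a∈′

  selector-∈ : {vs : List (Subset n)} → v ∈ vs → Proper v →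
               Σ (Proper v) (λ proper → selector v (G v) proper ∈ selectors vs)
  selector-∈ {vs = v ∷ vs} v∈ proper with proper? v | v∈
  ... | yes proper′ | here refl = proper′ , here refl
  ... | no  ¬proper | here refl = absurd (¬proper proper)
  ... | yes _       | there v∈′ = let (proper′ , s∈) = selector-∈ v∈′ proper in proper′ , there s∈
  ... | no  _       | there v∈′ = selector-∈ v∈′ proper

  system : ReactionSystem n
  system = selectors (allSubsets n)

  G-⊆-system : Proper X → G X ⊆ₛ res system X
  G-⊆-system {X = X} proper {x} x∈GX with selector-∈ (∈-allSubsets X) proper
  ... | proper′ , s∈ =
    resᵣ-⊆-res s∈ (subst (x ∈ₛ_) (sym (resᵣ-enabled (selector-enabled-at {Z = G X} proper′))) x∈GX)

  system-realises : G ⊥ ≡ ⊥ → G ⊤ ≡ ⊥ → (X : Subset n) → res system X ≡ G X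
  system-realises G∅ GS X = ⊆-antisym (res-⊆ system (selectors-⊆ (allSubsets n))) G-⊆
    where
    G-⊆ : G X ⊆ₛ res system X
    G-⊆ with proper? X
    ... | yes proper = G-⊆-system proper
    ... | no ¬proper with improper⇒∅⊎S ¬proper
    ...   | inj₁ refl = ⊥⊆ ∘ subst (_ ∈ₛ_) G∅
    ...   | inj₂ refl = ⊥⊆ ∘ subst (_ ∈ₛ_) GS

proposition5p5 : (n : ℕ) (G : OneOutGraph n) →
    (Σ (ReactionSystem n) (λ A → (v : Subset n) → zeroContextGraph A v ≡ G v))
    ⇔ (IsEdge G ⊥ ⊥ × IsEdge G ⊤ ⊥)
proposition5p5 n G = mk⇔ necessary sufficient
  where
  open Realisation G

  necessary : Σ (ReactionSystem n) (λ A → (v : Subset n) → res A v ≡ G v) → G ⊥ ≡ ⊥ × G ⊤ ≡ ⊥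
  necessary (A , realises) =
      trans (sym (realises ⊥)) (res-inert A (λ {a} _ → disabled-at-∅ a))
    , trans (sym (realises ⊤)) (res-inert A (λ {a} _ → disabled-at-S a))

  sufficient : G ⊥ ≡ ⊥ × G ⊤ ≡ ⊥ → Σ (ReactionSystem n) (λ A → (v : Subset n) → res A v ≡ G v)
  sufficient (G∅ , GS) = system , system-realises G∅ GS
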